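{- Let $G=(V,E)$ and $H=(V',E')$ be directed acyclic graphs with $G$ closed under transitivity (i.e. $(u,v)\in E$ whenever $v$ is reachable from $u$ and $u\neq v$), let $\chi=(\mathfrak m,\mathfrak M)$ be a monitor placement for $G$, and let $f:V\to V'$ be a bijective embedding $G\hookrightarrow_f H$; equip $H$ with $\chi^f=(f(\mathfrak m),f(\mathfrak M))$. Then $\mu(G\mid\chi)\ge\mu(H\mid\chi^f)$. In particular, for every DAG $G$ with transitive closure $G^*$ and any monitor placement $\chi$ (used for both), $\mu(G^*\mid\chi)\ge\mu(G\mid\chi)$.
   Context: For a DAG $G$, $u\preceq_G v$ means $v$ is reachable from $u$ by a directed path (including $u=v$). An embedding is an injective map $f$ with $u\preceq_G v$ iff $f(u)\preceq_H f(v)$. The transitive closure $G^*$ of $G$ has the same nodes and an edge $(u,v)$ whenever $u\neq v$ and $v$ is reachable from $u$ in $G$. A monitor placement specifies input nodes $\mathfrak m$ and output nodes $\mathfrak M$; the measurement paths are the directed paths from a node of $\mathfrak m$ to a node of $\mathfrak M$ (under $\mathrm{CSP}$: simple paths with distinct endpoints; under $\mathrm{CAP}^-$: all such directed walks except single-node paths on a node of $\mathfrak m\cap\mathfrak M$). $\mathbb P(v)$ is the set of measurement paths through $v$, $\mathbb P(U)=\bigcup_{u\in U}\mathbb P(u)$; the node set is $k$-identifiable if for all $U\ne W$ with $|U|,|W|\le k$, $\mathbb P(U)\neq\mathbb P(W)$; $\mu$ is the largest such $k\ge0$. -}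

module Defs where

open import Level using (0ℓ)
open import Data.Nat using (ℕ; _≤_)
open import Data.Fin using (Fin)
open import Data.Fin.Subset using (Subset; ∣_∣) renaming (_∈_ to _∈ₛ_)
open import Data.List using (List; []; _∷_; last)
open import Data.Maybe using (just)
open import Data.List.Relation.Unary.Linked using (Linked)
open import Data.List.Relation.Unary.Any using (Any)
open import Data.Product using (Σ; ∃; _×_; _,_)
open import Relation.Nullary using (¬_)
open import Relation.Unary using (Pred)
open import Relation.Binary using (Rel)
open import Relation.Binary.PropositionalEquality using (_≡_; _≢_)
open import Relation.Binary.Construct.Closure.ReflexiveTransitive using (Star)
open import Relation.Binary.Construct.Closure.Transitive using (TransClosure)
open import Function using (_⇔_)

Graph : ℕ → Set₁
Graph n = Rel (Fin n) 0ℓ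

_⊢_⪯_ : ∀ {n} → Graph n → Fin n → Fin n → Set
E ⊢ u ⪯ v = Star E u v

Acyclic : ∀ {n} → Graph n → Set
Acyclic E = ∀ u → ¬ TransClosure E u u

TransitivelyClosed : ∀ {n} → Graph n → Set
TransitivelyClosed E = ∀ u v → u ≢ v → E ⊢ u ⪯ v → E u v

TransClosureGraph : ∀ {n} → Graph n → Graph n
TransClosureGraph E u v = (u ≢ v) × (E ⊢ u ⪯ v)

record Placement (n : ℕ) : Set₁ where
  constructor placement
  field
    inputs  : Pred (Fin n) 0ℓ
    outputs : Pred (Fin n) 0ℓ
open Placement public

image : ∀ {n} → (Fin n → Fin n) → Pred (Fin n) 0ℓ → Pred (Fin n) 0ℓ
image f P x = ∃ λ u → P u × f u ≡ x

mapPlacement : ∀ {n} → (Fin n → Fin n) → Placement n → Placement n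
mapPlacement f χ = placement (image f (inputs χ)) (image f (outputs χ))

-- In a DAG
-- every walk is a simple path with distinct endpoints, so this is the
-- measurement-path set under both CSP and CAP⁻.
data MeasurementPath {n} (E : Graph n) (χ : Placement n) : List (Fin n) → Set where
  mpath : ∀ {x y rest z} → Linked E (x ∷ y ∷ rest) →
          inputs χ x → last (y ∷ rest) ≡ just z → outputs χ z →
          MeasurementPath E χ (x ∷ y ∷ rest)

ℙ : ∀ {n} → Graph n → Placement n → Subset n → Pred (List (Fin n)) 0ℓ
ℙ E χ U p = MeasurementPath E χ p × ∃ λ u → (u ∈ₛ U) × Any (u ≡_) p

_≐_ : ∀ {n} → Pred (List (Fin n)) 0ℓ → Pred (List (Fin n)) 0ℓ → Set
P ≐ Q = ∀ p → P p ⇔ Q p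

Identifiable : ∀ {n} → Graph n → Placement n → ℕ → Set
Identifiable {n} E χ k = ∀ (U W : Subset n) → ∣ U ∣ ≤ k → ∣ W ∣ ≤ k → U ≢ W →
                         ¬ (ℙ E χ U ≐ ℙ E χ W)

-- μ(G ∣ χ) ≥ μ(H ∣ χ') : every k for which H is k-identifiable also makes G
-- k-identifiable.  (k-identifiability is downward closed, so this is exactly
-- "the largest k for G is at least the largest k for H"; it also covers the
-- degenerate case where no largest k exists.)
μ≥ : ∀ {n} → Graph n → Placement n → Graph n → Placement n → Set
μ≥ G χ H χ' = ∀ k → Identifiable H χ' k → Identifiable G χ k

-- f is an embedding G ↪ H : injective and u ⪯_G v ⇔ f u ⪯_H f v.
-- (Injectivity is included in Bijective below.)
PreservesReach : ∀ {n} → Graph n → Graph n → (Fin n → Fin n) → Set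
PreservesReach G H f = ∀ u v → (G ⊢ u ⪯ v) ⇔ (H ⊢ f u ⪯ f v)

module Submission where

-- Identifiability can only drop when measurement paths are relabelled onto a
-- graph that has at least as many of them.
--
-- Let π be a permutation of the nodes, read as a map from the nodes of G to
-- those of H, and suppose every measurement path of H, pulled back along π⁻¹,
-- is a measurement path of G.  If distinct node sets U ≠ W of size ≤ k were
-- confused in G (ℙ_G(U) = ℙ_G(W)), then their images π(U) ≠ π(W), still of
-- size ≤ k, would be confused in H: a path of H through π(U) pulls back to a
-- path of G through U, hence through W, hence the original path passes
-- through π(W).  So μ(G) ≥ μ(H)  (lemma `μ≥-of-pullback`).
--
-- The two
-- parts of the theorem are the two instances: the inverse of an embedding
-- into a DAG maps H-edges to edges of the transitively closed G, and the
-- identity maps G-edges to G*-edges.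

open import Defs
open import Data.Nat using (ℕ; suc; _≤_)
open import Data.Nat.Properties using (+-0-commutativeMonoid)
open import Data.Bool using (Bool; true; false)
open import Data.Fin using (Fin)
open import Data.Fin.Subset using (Subset; ∣_∣) renaming (_∈_ to _∈ₛ_)
open import Data.Fin.Permutation
  using (Permutation′; _⟨$⟩ʳ_; _⟨$⟩ˡ_; inverseˡ; inverseʳ; permutation; flip)
  renaming (id to idₚ)
open import Data.Vec using ([]; _∷_; lookup; tabulate)
open import Data.Vec.Properties
  using (lookup∘tabulate; tabulate∘lookup; tabulate-cong; []=⇒lookup; lookup⇒[]=)
open import Data.List using (_∷_; map)
open import Data.List.Properties using (last-map)
import Data.List.Relation.Unary.Any as Any
open import Data.List.Relation.Unary.Any.Properties using (map⁺; map⁻)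
import Data.List.Relation.Unary.Linked as Linked
open import Data.List.Relation.Unary.Linked.Properties using () renaming (map⁺ to linked-map⁺)
import Data.Maybe as Maybe
open import Data.Product using (_×_; _,_; proj₁; proj₂)
open import Function using (_∘_; mk⇔; Equivalence)
open import Function.Definitions using (Bijective)
open import Relation.Binary.PropositionalEquality
  using (_≡_; refl; sym; trans; cong; subst; subst₂; module ≡-Reasoning)
open import Relation.Binary.Construct.Closure.ReflexiveTransitive using (ε; _◅_)
open import Relation.Binary.Construct.Closure.Transitive using ([_])
open import Relation.Unary using (Pred)
open import Algebra.Properties.CommutativeMonoid.Sum +-0-commutativeMonoid using (sum; sum-cong-≗; sum-permute)

relabel : ∀ {n} → Permutation′ n → Subset n → Subset n
relabel π U = tabulate (lookup U ∘ (π ⟨$⟩ˡ_))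

indicator : Bool → ℕ
indicator true  = 1
indicator false = 0

∣∣≡sum : ∀ {n} (U : Subset n) → ∣ U ∣ ≡ sum (indicator ∘ lookup U)
∣∣≡sum []          = refl
∣∣≡sum (true ∷ U)  = cong suc (∣∣≡sum U)
∣∣≡sum (false ∷ U) = ∣∣≡sum U

∣relabel∣ : ∀ {n} (π : Permutation′ n) U → ∣ relabel π U ∣ ≡ ∣ U ∣
∣relabel∣ π U = begin
  ∣ relabel π U ∣                          ≡⟨ ∣∣≡sum (relabel π U) ⟩
  sum (indicator ∘ lookup (relabel π U))   ≡⟨ sum-cong-≗ (cong indicator ∘ lookup∘tabulate (lookup U ∘ (π ⟨$⟩ˡ_))) ⟩
  sum (indicator ∘ lookup U ∘ (π ⟨$⟩ˡ_))   ≡⟨ sum-permute (indicator ∘ lookup U) (flip π) ⟨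
  sum (indicator ∘ lookup U)               ≡⟨ ∣∣≡sum U ⟨
  ∣ U ∣                                    ∎
  where open ≡-Reasoning

relabel-inverse : ∀ {n} (π : Permutation′ n) U → relabel (flip π) (relabel π U) ≡ U
relabel-inverse π U = trans (tabulate-cong undo) (tabulate∘lookup U)
  where
  undo : ∀ x → lookup (relabel π U) (π ⟨$⟩ʳ x) ≡ lookup U x
  undo x = trans (lookup∘tabulate (lookup U ∘ (π ⟨$⟩ˡ_)) (π ⟨$⟩ʳ x)) (cong (lookup U) (inverseˡ π))

relabel-injective : ∀ {n} (π : Permutation′ n) {U W} → relabel π U ≡ relabel π W → U ≡ W
relabel-injective π {U} {W} eq =
  trans (sym (relabel-inverse π U)) (trans (cong (relabel (flip π)) eq) (relabel-inverse π W))

∈relabel⁻ : ∀ {n} (π : Permutation′ n) {U y} → y ∈ₛ relabel π U → π ⟨$⟩ˡ y ∈ₛ U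
∈relabel⁻ π {U} {y} y∈ =
  lookup⇒[]= _ U (trans (sym (lookup∘tabulate (lookup U ∘ (π ⟨$⟩ˡ_)) y)) ([]=⇒lookup y∈))

∈relabel⁺ : ∀ {n} (π : Permutation′ n) {U x} → x ∈ₛ U → π ⟨$⟩ʳ x ∈ₛ relabel π U
∈relabel⁺ π {U} {x} x∈ = lookup⇒[]= _ (relabel π U) (begin
  lookup (relabel π U) (π ⟨$⟩ʳ x)   ≡⟨ lookup∘tabulate (lookup U ∘ (π ⟨$⟩ˡ_)) (π ⟨$⟩ʳ x) ⟩
  lookup U (π ⟨$⟩ˡ (π ⟨$⟩ʳ x))      ≡⟨ cong (lookup U) (inverseˡ π) ⟩
  lookup U x                        ≡⟨ []=⇒lookup x∈ ⟩
  true                              ∎)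
  where open ≡-Reasoning

map-measurementPath : ∀ {n} {E E′ : Graph n} {χ χ′ : Placement n} (h : Fin n → Fin n) →
  (∀ {a b} → E a b → E′ (h a) (h b)) →
  (∀ {x} → inputs χ x → inputs χ′ (h x)) →
  (∀ {x} → outputs χ x → outputs χ′ (h x)) →
  ∀ {p} → MeasurementPath E χ p → MeasurementPath E′ χ′ (map h p)
map-measurementPath h edge input output (mpath {y = y} {rest} linked x-in last≡z z-out) =
  mpath (linked-map⁺ (Linked.map edge linked)) (input x-in)
        (trans (last-map h (y ∷ rest)) (cong (Maybe.map h) last≡z)) (output z-out)

image-inverse : ∀ {n} {f g : Fin n → Fin n} {P : Pred (Fin n) _} →
  (∀ u → g (f u) ≡ u) → ∀ {x} → image f P x → P (g x)
image-inverse {P = P} gf (u , Pu , fu≡x) = subst P (trans (sym (gf u)) (cong _ fu≡x)) Pu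

module Pullback {n} {G H : Graph n} {χ χ′ : Placement n} (π : Permutation′ n)
  (pullback : ∀ {q} → MeasurementPath H χ′ q → MeasurementPath G χ (map (π ⟨$⟩ˡ_) q)) where

  confusion-transfers : ∀ {U W} → ℙ G χ U ≐ ℙ G χ W →
    ∀ q → ℙ H χ′ (relabel π U) q → ℙ H χ′ (relabel π W) q
  confusion-transfers {U} {W} U≐W q (q-path , y , y∈πU , y∈q)
    with Equivalence.to (U≐W (map (π ⟨$⟩ˡ_) q))
           (pullback q-path , π ⟨$⟩ˡ y , ∈relabel⁻ π y∈πU , map⁺ (Any.map (cong _) y∈q))
  ... | _ , w , w∈W , w∈gq =
    q-path , π ⟨$⟩ʳ w , ∈relabel⁺ π w∈W ,
    Any.map (λ w≡gy → trans (cong (π ⟨$⟩ʳ_) w≡gy) (inverseʳ π)) (map⁻ w∈gq)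

  confusion-transfers-≐ : ∀ {U W} → ℙ G χ U ≐ ℙ G χ W →
    ℙ H χ′ (relabel π U) ≐ ℙ H χ′ (relabel π W)
  confusion-transfers-≐ U≐W q =
    mk⇔ (confusion-transfers U≐W q)
        (confusion-transfers (λ p → mk⇔ (Equivalence.from (U≐W p)) (Equivalence.to (U≐W p))) q)

  μ≥-of-pullback : μ≥ G χ H χ′
  μ≥-of-pullback k H-ident U W ∣U∣≤k ∣W∣≤k U≢W U≐W =
    H-ident (relabel π U) (relabel π W)
      (subst (_≤ k) (sym (∣relabel∣ π U)) ∣U∣≤k) (subst (_≤ k) (sym (∣relabel∣ π W)) ∣W∣≤k)
      (U≢W ∘ relabel-injective π) (confusion-transfers-≐ U≐W)

open Pullback using (μ≥-of-pullback)

-- An embedding into a DAG reflects edges into a transitively closed graph: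
-- an edge f u → f v gives u ⪯ v, and u ≠ v since H has no self-loops.
embedding-reflects-edges : ∀ {n} {G H : Graph n} {f : Fin n → Fin n} →
  Acyclic H → TransitivelyClosed G → PreservesReach G H f →
  ∀ {u v} → H (f u) (f v) → G u v
embedding-reflects-edges {H = H} {f} acyclic-H closed-G reach {u} {v} e =
  closed-G u v (λ u≡v → acyclic-H (f u) [ subst (H (f u) ∘ f) (sym u≡v) e ])
               (Equivalence.from (reach u v) (e ◅ ε))

-- First part: μ(G ∣ χ) ≥ μ(H ∣ χ^f) for a bijective embedding f.
μ≥-embedding : ∀ n (G H : Graph n) (χ : Placement n) (f : Fin n → Fin n) →
  Acyclic H → TransitivelyClosed G → Bijective _≡_ _≡_ f → PreservesReach G H f →
  μ≥ G χ H (mapPlacement f χ)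
μ≥-embedding n G H χ f acyclic-H closed-G (f-injective , f-surjective) reach =
  μ≥-of-pullback π (map-measurementPath g edge (image-inverse g∘f) (image-inverse g∘f))
  where
  g : Fin n → Fin n
  g y = proj₁ (f-surjective y)
  f∘g : ∀ y → f (g y) ≡ y
  f∘g y = proj₂ (f-surjective y) refl
  g∘f : ∀ x → g (f x) ≡ x
  g∘f x = f-injective (f∘g (f x))
  π : Permutation′ n
  π = permutation f g f∘g g∘f
  edge : ∀ {a b} → H a b → G (g a) (g b)
  edge {a} {b} e =
    embedding-reflects-edges acyclic-H closed-G reach (subst₂ H (sym (f∘g a)) (sym (f∘g b)) e)

μ≥-closure : ∀ n (G : Graph n) (χ : Placement n) → Acyclic G → μ≥ (TransClosureGraph G) χ G χ
μ≥-closure n G χ acyclic-G = μ≥-of-pullback idₚ (map-measurementPath (λ x → x) edge (λ i → i) (λ o → o))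
  where
  edge : ∀ {a b} → G a b → TransClosureGraph G a b
  edge {a} e = (λ a≡b → acyclic-G a [ subst (G a) (sym a≡b) e ]) , e ◅ ε

lemma9 : (∀ (n : ℕ) (G H : Graph n) (χ : Placement n) (f : Fin n → Fin n) →
              Acyclic G → Acyclic H → TransitivelyClosed G →
              Bijective _≡_ _≡_ f → PreservesReach G H f →
              μ≥ G χ H (mapPlacement f χ))
           × (∀ (n : ℕ) (G : Graph n) (χ : Placement n) →
              Acyclic G → μ≥ (TransClosureGraph G) χ G χ)
-- The theorem is the conjunction of the two parts.
lemma9 = (λ n G H χ f _ acyclic-H closed-G → μ≥-embedding n G H χ f acyclic-H closed-G)
       , μ≥-closure
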